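{- Let $n_1,n_2,l_1,l_2,t$ be positive integers with $l=\min(l_1,l_2)\geq t+2$. Let $\mathcal A\subseteq P(n_1,l_1)$ and $\mathbf v\in P(n_2,l_2)$. Let $1\leq x_1<x_2<\cdots<x_t\leq l$ and let $y_1,\dots,y_t$ be non-negative integers. If $\mathcal A^*(x_1,\dots,x_t;y_1,\dots,y_t)$ contains an independent set of size at least $l-t+1$, then either (a) $|I(\mathbf v,\mathbf u)|\leq t-1$ for some $\mathbf u\in\mathcal A$, or (b) $\mathbf v(x_i)=y_i$ for all $i=1,\dots,t$.
   Context: $\mathbb N_0$ denotes the set of non-negative integers. For positive integers $n,k$, $P(n,k)=\{(x_1,\dots,x_k)\in\mathbb N_0^k : x_1+\cdots+x_k=n\}$; for $\mathbf u=(u_1,\dots,u_k)\in P(n,k)$, $\mathbf u(i)=u_i$. For $\mathbf u\in P(m_1,k_1)$ and $\mathbf w\in P(m_2,k_2)$, $I(\mathbf u,\mathbf w)=\{i\in\{1,\dots,\min(k_1,k_2)\} : \mathbf u(i)=\mathbf w(i)\}$. A family $\mathcal B\subseteq P(m,k)$ is independent if $I(\mathbf u,\mathbf w)=\varnothing$ for all distinct $\mathbf u,\mathbf w\in\mathcal B$. For $\mathbf u\in P(n,k)$ and distinct indices $x_1<\cdots<x_t$ in $\{1,\dots,k\}$, $R(x_1,\dots,x_t;\mathbf u)$ denotes the tuple obtained from $\mathbf u$ by deleting the coordinates in positions $x_1,\dots,x_t$ (keeping the order of the remaining coordinates). For $\mathcal A\subseteq P(n,k)$, $\mathcal A(x_1,\dots,x_t;y_1,\dots,y_t)=\{\mathbf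 u\in\mathcal A : \mathbf u(x_i)=y_i \text{ for all } i\}$ and $\mathcal A^*(x_1,\dots,x_t;y_1,\dots,y_t)=\{R(x_1,\dots,x_t;\mathbf u) : \mathbf u\in\mathcal A(x_1,\dots,x_t;y_1,\dots,y_t)\}\subseteq P(n-\sum_i y_i,\,k-t)$. -}

module Defs where

open import Data.Nat using (ℕ; zero; suc; _+_; _≤_; _<_; _⊓_; _≟_)
open import Data.List using (List; []; _∷_; length; filter; map; upTo)
open import Data.Nat.ListAction using (sum)
open import Data.List.Membership.DecPropositional _≟_ using (_∈?_)
open import Data.List.Relation.Unary.Unique.Propositional using (Unique)
open import Data.List.Relation.Unary.AllPairs using (AllPairs)
open import Data.List.Relation.Unary.All using (All)
open import Data.Vec using (Vec; toList; lookup)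
open import Data.Fin using (Fin)
open import Data.Product using (Σ; _×_)
open import Relation.Binary.PropositionalEquality using (_≡_)
open import Relation.Nullary using (yes; no)

-- Tuples are lists of naturals; coordinates are 1-based.
-- P(n,k) membership: length k and coordinate sum n.
InP : ℕ → ℕ → List ℕ → Set
InP n k u = (length u ≡ k) × (sum u ≡ n)

-- u(i), 1-based (returns 0 outside 1..length u; only used in range).
coord : List ℕ → ℕ → ℕ
coord [] _ = 0
coord (a ∷ u) zero = 0
coord (a ∷ u) (suc zero) = a
coord (a ∷ u) (suc (suc i)) = coord u (suc i)

I : List ℕ → List ℕ → List ℕ
I u w = filter (λ i → coord u i ≟ coord w i)
               (map suc (upTo (length u ⊓ length w)))

Independent : List (List ℕ) → Set
Independent B = AllPairs (λ u w → I u w ≡ []) B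

delFrom : List ℕ → ℕ → List ℕ → List ℕ
delFrom xs i [] = []
delFrom xs i (a ∷ u) with i ∈? xs
... | yes _ = delFrom xs (suc i) u
... | no _  = a ∷ delFrom xs (suc i) u

R : List ℕ → List ℕ → List ℕ
R xs u = delFrom xs 1 u

Fixes : {t : ℕ} → Vec ℕ t → Vec ℕ t → List ℕ → Set
Fixes {t} xs ys u = (i : Fin t) → coord u (lookup xs i) ≡ lookup ys i

Astar : (List ℕ → Set) → {t : ℕ} → Vec ℕ t → Vec ℕ t → List ℕ → Set
Astar A xs ys w = Σ (List ℕ) (λ u → A u × Fixes xs ys u × (R (toList xs) u ≡ w))

-- Suppose v(x_i) ≠ y_i for some i. A member u of A(x;y) that agrees with v
-- nowhere outside {x_1,…,x_t} has I(v,u) ⊆ {x_1,…,x_t} ∖ {x_i}, so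
-- |I(v,u)| ≤ t - 1. Otherwise every w = R(x;u) in the independent family B
-- comes with a position j ∉ {x_1,…,x_t} where u agrees with v. Two members of
-- B cannot share such a j: deleting the same coordinates from u and u' moves
-- j to the same place, where the deletions would then agree. So B injects
-- into the l - t positions outside {x_1,…,x_t}, contradicting |B| ≥ l - t + 1.
module Submission where

open import Defs
open import Data.Nat using (ℕ; suc; zero; _+_; _∸_; _≤_; _<_; _⊓_; _≟_; z≤n; s≤s; z<s; s<s)
open import Data.Nat.Properties
  using (+-identityʳ; +-suc; +-comm; ⊓-comm; ⊓-glb; m⊓n≤m; ≤-trans; <⇒≢; n≮n; suc-injective;
         ∸-monoˡ-≤; m+n≤o⇒m≤o∸n; module ≤-Reasoning)
open import Data.Fin using (Fin) renaming (_<_ to _<ᶠ_)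
import Data.Fin.Properties as Fin
open import Data.Vec using (Vec; lookup; toList; _∷_; [])
open import Data.Vec.Properties using (length-toList)
open import Data.Vec.Relation.Unary.All.Properties using (toList⁺; lookup⁻)
open import Data.Vec.Membership.Propositional.Properties using (∈-lookup; ∈-toList⁺)
open import Data.List using (List; length; map; upTo; _++_; _∷_; [])
open import Data.List.Properties using (length-map; length-upTo; length-++; length-removeAt′)
open import Data.List.Relation.Unary.All using (All; _∷_; [])
import Data.List.Relation.Unary.All as All
open import Data.List.Relation.Unary.All.Properties using (¬Any⇒All¬)
open import Data.List.Relation.Unary.Any using (Any; here; there; index; _─_; any?)
open import Data.List.Relation.Unary.Any.Properties using (¬Any[])
open import Data.List.Relation.Unary.AllPairs using (AllPairs; _∷_; [])
import Data.List.Relation.Unary.AllPairs.Properties as AllPairs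
open import Data.List.Relation.Unary.Unique.Propositional using (Unique)
open import Data.List.Relation.Unary.Unique.Propositional.Properties using (upTo⁺; map⁺; filter⁺)
open import Data.List.Relation.Binary.Subset.Propositional using (_⊆_)
open import Data.List.Membership.Propositional using (_∈_; _∉_; find; lose)
open import Data.List.Membership.Propositional.Properties
  using (∈-map⁺; ∈-map⁻; ∈-upTo⁺; ∈-upTo⁻; ∈-filter⁺; ∈-filter⁻; ∈-++⁻)
open import Data.List.Membership.DecPropositional _≟_ using (_∈?_)
open import Data.Product using (Σ; _×_; _,_; proj₁; proj₂; map₂)
open import Data.Sum using (_⊎_; inj₁; inj₂; [_,_]′)
import Data.Sum as Sum
open import Data.Empty using (⊥; ⊥-elim)
open import Function using (_∘_)
open import Relation.Nullary using (¬_; yes; no)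
open import Relation.Nullary.Decidable using (¬?; _×-dec_; decidable-stable)
open import Relation.Unary using (Decidable)
open import Relation.Binary.PropositionalEquality using (_≡_; _≢_; refl; sym; trans; cong; cong₂; subst)

module _ {a} {A : Set a} where

  ∈-─⁺ : ∀ {x y} {xs : List A} (x∈xs : x ∈ xs) → y ∈ xs → y ≢ x → y ∈ (xs ─ x∈xs)
  ∈-─⁺ (here refl)  (here refl)  y≢x = ⊥-elim (y≢x refl)
  ∈-─⁺ (here refl)  (there y∈xs) _   = y∈xs
  ∈-─⁺ (there _)    (here refl)  _   = here refl
  ∈-─⁺ (there x∈xs) (there y∈xs) y≢x = there (∈-─⁺ x∈xs y∈xs y≢x)

  Unique-⊆⇒length≤ : ∀ {xs ys : List A} → Unique xs → xs ⊆ ys → length xs ≤ length ys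
  Unique-⊆⇒length≤ {[]}     _                 _     = z≤n
  Unique-⊆⇒length≤ {x ∷ xs} {ys} (x∉xs ∷ uniq) xs⊆ys =
    subst (suc (length xs) ≤_) (sym (length-removeAt′ ys (index x∈ys)))
      (s≤s (Unique-⊆⇒length≤ uniq xs⊆ys─x))
    where
    x∈ys = xs⊆ys (here refl)
    xs⊆ys─x : xs ⊆ (ys ─ x∈ys)
    xs⊆ys─x y∈xs = ∈-─⁺ x∈ys (xs⊆ys (there y∈xs)) (λ y≡x → All.lookup x∉xs y∈xs (sym y≡x))

  All⊎⇒⊎All : ∀ {p} {P : A → Set p} {q} {Q : Set q} {xs} → All (λ x → P x ⊎ Q) xs → Q ⊎ All P xs
  All⊎⇒⊎All []              = inj₂ []
  All⊎⇒⊎All (inj₂ q  ∷ _)   = inj₁ q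
  All⊎⇒⊎All (inj₁ px ∷ pxs) = Sum.map₂ (px ∷_) (All⊎⇒⊎All pxs)

  module _ {p} {P : A → Set p} {b} {B : Set b} (f : ∀ {x} → P x → B) where

    length-reduce : ∀ {xs} (pxs : All P xs) → length (All.reduce f pxs) ≡ length xs
    length-reduce []        = refl
    length-reduce (_ ∷ pxs) = cong suc (length-reduce pxs)

    All-reduce⁺ : ∀ {q} {Q : B → Set q} → (∀ {x} (px : P x) → Q (f px)) →
                  ∀ {xs} (pxs : All P xs) → All Q (All.reduce f pxs)
    All-reduce⁺ Qf []         = []
    All-reduce⁺ Qf (px ∷ pxs) = Qf px ∷ All-reduce⁺ Qf pxs

    AllPairs-reduce⁺ : ∀ {r s} {R : A → A → Set r} {S : B → B → Set s} →
                       (∀ {x y} (px : P x) (py : P y) → R x y → S (f px) (f py)) →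
                       ∀ {xs} → AllPairs R xs → (pxs : All P xs) → AllPairs S (All.reduce f pxs)
    AllPairs-reduce⁺ Sf []         []         = []
    AllPairs-reduce⁺ {R = R} {S} Sf {x ∷ _} (Rx ∷ Rxs) (px ∷ pxs) =
      related Rx pxs ∷ AllPairs-reduce⁺ Sf Rxs pxs
      where
      related : ∀ {ys} → All (R x) ys → (pys : All P ys) → All (S (f px)) (All.reduce f pys)
      related []           []         = []
      related (Rxy ∷ Rxys) (py ∷ pys) = Sf px py Rxy ∷ related Rxys pys

strictlyIncreasing⇒Unique : ∀ {t} (xs : Vec ℕ t) →
  (∀ i j → i <ᶠ j → lookup xs i < lookup xs j) → Unique (toList xs)
strictlyIncreasing⇒Unique []       _   = []
strictlyIncreasing⇒Unique (x ∷ xs) inc =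
  toList⁺ (lookup⁻ (λ i → <⇒≢ (inc Fin.zero (Fin.suc i) z<s)))
  ∷ strictlyIncreasing⇒Unique xs (λ i j i<j → inc (Fin.suc i) (Fin.suc j) (s<s i<j))

positions : ℕ → List ℕ
positions l = map suc (upTo l)

∈-positions⁺ : ∀ {j l} → 1 ≤ j → j ≤ l → j ∈ positions l
∈-positions⁺ {suc p} _ p<l = ∈-map⁺ suc (∈-upTo⁺ p<l)

length-positions : ∀ l → length (positions l) ≡ l
length-positions l = trans (length-map suc (upTo l)) (length-upTo l)

Unique-I : ∀ u w → Unique (I u w)
Unique-I u w = filter⁺ _ (map⁺ suc-injective (upTo⁺ (length u ⊓ length w)))

-- The entry at offset p of u sits at offset offsetAfterDelete X i p of
-- delFrom X i u, where i is the (1-based) position of the head of u.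
offsetAfterDelete : List ℕ → ℕ → ℕ → ℕ
offsetAfterDelete X i zero = zero
offsetAfterDelete X i (suc p) with i ∈? X
... | yes _ = offsetAfterDelete X (suc i) p
... | no _  = suc (offsetAfterDelete X (suc i) p)

coord-delFrom : ∀ X i u p → p < length u → i + p ∉ X →
  coord (delFrom X i u) (suc (offsetAfterDelete X i p)) ≡ coord u (suc p)
  × offsetAfterDelete X i p < length (delFrom X i u)
coord-delFrom X i (a ∷ u) zero _ i∉X with i ∈? X
... | yes i∈X = ⊥-elim (i∉X (subst (_∈ X) (sym (+-identityʳ i)) i∈X))
... | no _    = refl , z<s
coord-delFrom X i (a ∷ u) (suc p) (s<s p<|u|) i+1+p∉X
  with i ∈? X | coord-delFrom X (suc i) u p p<|u| (i+1+p∉X ∘ subst (_∈ X) (sym (+-suc i p)))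
... | yes _ | shifted = shifted
... | no _  | shifted = map₂ s<s shifted

deletions-agree : ∀ X u u' {p} → p < length u → p < length u' → suc p ∉ X →
  coord u (suc p) ≡ coord u' (suc p) → I (R X u) (R X u') ≢ []
deletions-agree X u u' {p} p<|u| p<|u'| p+1∉X u≡u' I≡[]
  with coord-delFrom X 1 u p p<|u| p+1∉X | coord-delFrom X 1 u' p p<|u'| p+1∉X
... | Ru≡u , k≤|Ru| | Ru'≡u' , k≤|Ru'| =
  ¬Any[] (subst (k ∈_) I≡[] (∈-filter⁺ _ k∈positions (trans Ru≡u (trans u≡u' (sym Ru'≡u')))))
  where
  k = suc (offsetAfterDelete X 1 p)
  k∈positions = ∈-positions⁺ z<s (⊓-glb k≤|Ru| k≤|Ru'|)

module OutsideAgreements (v : List ℕ) {t : ℕ} (xs : Vec ℕ t) (l : ℕ) where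

  X : List ℕ
  X = toList xs

  AgreesOutside : List ℕ → ℕ → Set
  AgreesOutside u j = j ∉ X × coord u j ≡ coord v j

  agreesOutside? : ∀ u → Decidable (AgreesOutside u)
  agreesOutside? u j = ¬? (j ∈? X) ×-dec (coord u j ≟ coord v j)

  record OutsideAgreement (w : List ℕ) : Set where
    constructor outsideAgreement
    field
      preimage  : List ℕ
      l≤length  : l ≤ length preimage
      deletes   : R X preimage ≡ w
      position  : ℕ
      position∈ : position ∈ positions l
      agrees    : AgreesOutside preimage position

  open OutsideAgreement

  independent⇒position≢ : ∀ {w w'} (a : OutsideAgreement w) (a' : OutsideAgreement w') →
                       I w w' ≡ [] → position a ≢ position a'
  independent⇒position≢ (outsideAgreement u l≤|u| refl j j∈ (j∉X , uj≡vj))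
                     (outsideAgreement u' l≤|u'| refl _ _ (_ , u'j≡vj)) I≡[] refl
    with ∈-map⁻ suc j∈
  ... | p , p∈ , refl =
    deletions-agree X u u' (≤-trans p<l l≤|u|) (≤-trans p<l l≤|u'|) j∉X (trans uj≡vj (sym u'j≡vj)) I≡[]
    where p<l = ∈-upTo⁻ p∈

  independent-length-bound : Unique X → X ⊆ positions l →
    ∀ {B} → Independent B → All OutsideAgreement B → length B + t ≤ l
  independent-length-bound uniqueX X⊆positions {B} independent agreements = begin
    length B + t                     ≡⟨ cong₂ _+_ (length-reduce position agreements) (length-toList xs) ⟨
    length js + length X             ≡⟨ length-++ js ⟨
    length (js ++ X)                 ≤⟨ Unique-⊆⇒length≤ unique sub ⟩
    length (positions l)             ≡⟨ length-positions l ⟩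
    l                                ∎
    where
    open ≤-Reasoning
    js = All.reduce position agreements
    unique : Unique (js ++ X)
    unique = AllPairs.++⁺ (AllPairs-reduce⁺ position independent⇒position≢ independent agreements) uniqueX
               (All-reduce⁺ position (λ a → ¬Any⇒All¬ X (proj₁ (agrees a))) agreements)
    sub : js ++ X ⊆ positions l
    sub j∈ = [ All.lookup (All-reduce⁺ position position∈ agreements) , X⊆positions ]′ (∈-++⁻ js j∈)

  few-agreements : ∀ {ys : Vec ℕ t} {u} (i : Fin t) → coord v (lookup xs i) ≢ lookup ys i →
    Fixes xs ys u → length v ⊓ length u ≡ l → ¬ Any (AgreesOutside u) (positions l) →
    length (I v u) ≤ t ∸ 1
  few-agreements {ys} {u} i v≢y u-fixes |v|⊓|u|≡l no-agreement = ∸-monoˡ-≤ 1 (begin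
    length (lookup xs i ∷ I v u)     ≤⟨ Unique-⊆⇒length≤ unique sub ⟩
    length X                         ≡⟨ length-toList xs ⟩
    t                                ∎)
    where
    open ≤-Reasoning
    agreement : ∀ {k} → k ∈ I v u → k ∈ positions (length v ⊓ length u) × coord v k ≡ coord u k
    agreement = ∈-filter⁻ (λ k → coord v k ≟ coord u k)
    x∉I : lookup xs i ∉ I v u
    x∉I x∈I = v≢y (trans (proj₂ (agreement x∈I)) (u-fixes i))
    I⊆X : I v u ⊆ X
    I⊆X {k} k∈I = decidable-stable (k ∈? X) λ k∉X →
      no-agreement (lose (subst (λ m → k ∈ positions m) |v|⊓|u|≡l (proj₁ (agreement k∈I)))
                         (k∉X , sym (proj₂ (agreement k∈I))))
    unique : Unique (lookup xs i ∷ I v u)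
    unique = ¬Any⇒All¬ (I v u) x∉I ∷ Unique-I v u
    sub : lookup xs i ∷ I v u ⊆ X
    sub (here refl) = ∈-toList⁺ (∈-lookup i xs)
    sub (there k∈I) = I⊆X k∈I

member-with-few-agreements :
  ∀ {l₁ l₂ t} (A : List ℕ → Set) → (∀ u → A u → length u ≡ l₁) →
  (v : List ℕ) → length v ≡ l₂ → (xs ys : Vec ℕ t) →
  Unique (toList xs) → toList xs ⊆ positions (l₁ ⊓ l₂) →
  (i : Fin t) → coord v (lookup xs i) ≢ lookup ys i →
  ∀ {B} → All (Astar A xs ys) B → Independent B → (l₁ ⊓ l₂) ∸ t + 1 ≤ length B →
  Σ (List ℕ) λ u → A u × length (I v u) ≤ t ∸ 1
member-with-few-agreements {l₁} {l₂} {t} A |A|≡l₁ v |v|≡l₂ xs ys uniqueX X⊆positions i v≢y {B}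
                           B⊆A* independent l∸t+1≤|B| =
  [ (λ (u , Au , u-fixes , ¬agree) → u , Au , few-agreements {ys} {u} i v≢y u-fixes (|v|⊓|u|≡l Au) ¬agree)
  , (λ agreements → ⊥-elim (too-long (independent-length-bound uniqueX X⊆positions independent agreements)))
  ]′ (All⊎⇒⊎All (All.map classify B⊆A*))
  where
  l = l₁ ⊓ l₂
  open OutsideAgreements v xs l

  |v|⊓|u|≡l : ∀ {u} → A u → length v ⊓ length u ≡ l
  |v|⊓|u|≡l {u} Au = trans (cong₂ _⊓_ |v|≡l₂ (|A|≡l₁ u Au)) (⊓-comm l₂ l₁)

  classify : ∀ {w} → Astar A xs ys w →
    OutsideAgreement w ⊎ Σ (List ℕ) (λ u → A u × Fixes xs ys u × ¬ Any (AgreesOutside u) (positions l))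
  classify (u , Au , u-fixes , refl) with any? (agreesOutside? u) (positions l)
  ... | no ¬agree = inj₂ (u , Au , u-fixes , ¬agree)
  ... | yes agree = let (j , j∈ , agrees) = find agree in
    inj₁ (outsideAgreement u (subst (l ≤_) (sym (|A|≡l₁ u Au)) (m⊓n≤m l₁ l₂)) refl j j∈ agrees)

  too-long : length B + t ≤ l → ⊥
  too-long |B|+t≤l = n≮n (l ∸ t)
    (subst (_≤ l ∸ t) (+-comm (l ∸ t) 1) (≤-trans l∸t+1≤|B| (m+n≤o⇒m≤o∸n (length B) |B|+t≤l)))

lemma2p3 : (n₁ n₂ l₁ l₂ t : ℕ) → 1 ≤ n₁ → 1 ≤ n₂ → 1 ≤ l₁ → 1 ≤ l₂ → 1 ≤ t →
    t + 2 ≤ l₁ ⊓ l₂ →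
    (A : List ℕ → Set) → (∀ u → A u → InP n₁ l₁ u) →
    (v : List ℕ) → InP n₂ l₂ v →
    (xs ys : Vec ℕ t) →
    (∀ i → 1 ≤ lookup xs i) → (∀ i → lookup xs i ≤ l₁ ⊓ l₂) →
    (∀ i j → i <ᶠ j → lookup xs i < lookup xs j) →
    (Σ (List (List ℕ)) λ B → All (Astar A xs ys) B × Unique B × Independent B
        × ((l₁ ⊓ l₂) ∸ t + 1 ≤ length B)) →
    (Σ (List ℕ) λ u → A u × length (I v u) ≤ t ∸ 1)
      ⊎ ((i : Fin t) → coord v (lookup xs i) ≡ lookup ys i)
lemma2p3 _ _ l₁ l₂ t _ _ _ _ _ _ A A⊆P v (|v|≡l₂ , _) xs ys 1≤xs xs≤l xs-increasing
         (B , B⊆A* , _ , independent , l∸t+1≤|B|)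
  with Fin.all? (λ i → coord v (lookup xs i) ≟ lookup ys i)
... | yes v-fixes = inj₂ v-fixes
... | no ¬v-fixes with Fin.¬∀⟶∃¬ t _ (λ i → coord v (lookup xs i) ≟ lookup ys i) ¬v-fixes
...   | i , v≢y =
  inj₁ (member-with-few-agreements A (λ u Au → proj₁ (A⊆P u Au)) v |v|≡l₂ xs ys
          (strictlyIncreasing⇒Unique xs xs-increasing) X⊆positions i v≢y B⊆A* independent l∸t+1≤|B|)
  where
  X⊆positions : toList xs ⊆ positions (l₁ ⊓ l₂)
  X⊆positions = All.lookup (toList⁺ (lookup⁻ (λ i → ∈-positions⁺ (1≤xs i) (xs≤l i))))
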